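{- Let $R$ be a ring, let $\{N_1,\dots,N_k\}$ be a collection of ideals of $R$ satisfying the CNC-condition, and let $s_i$ be the characteristic of $N_i$ in $N_{i+1}$ ($i=1,\dots,k-1$). Then: (1) If $w$ is a natural number with $(x+N_1)^w=1+N_1$ for all $x+N_1\in (R/N_1)^*$, then $x^{w s_1\cdots s_{k-1}}=1$ for all $x\in R^*$. (2) If $(R/N_1)^*$ is finite, then $x^{|(R/N_1)^*|\, s_1\cdots s_{k-1}}=1$ for all $x\in R^*$. (3) If $R^*$ is finite, then $x^{|(R/N_1)^*|\,|N_1|}=1$ for all $x\in R^*$.
   Context: Rings are associative with identity, not necessarily commutative; $S^*$ denotes the group of units of a ring $S$. A collection $\{N_1,\dots,N_k\}$ of ideals of $R$ satisfies the CNC-condition if: (i) $\{0\}=N_k\subset N_{k-1}\subset\cdots\subset N_1\subset R$; (ii) for each $i=1,\dots,k-1$ there is $t_i\ge 2$ with $N_i^{t_i}\subset N_{i+1}$ (the minimal such $t_i$ is the nilpotency index of $N_i$ in $N_{i+1}$); (iii) for each $i=1,\dots,k-1$ there is $s_i\ge 1$ with $s_iN_i\subset N_{i+1}$ and all prime factors of $s_i$ are $\ge t_i$; the minimal such $s_i$ is called the characteristic of $N_i$ in $N_{i+1}$. -}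

module Defs where

open import Level using (Level; _⊔_) renaming (suc to lsuc)
open import Algebra.Bundles using (Ring)
open import Data.Nat as ℕ using (ℕ; zero; suc; _≤_; _<_; _∸_)
open import Data.Nat.Divisibility using (_∣_)
open import Data.Nat.Primality using (Prime)
open import Data.Fin using (Fin)
open import Data.Product using (Σ; ∃; _×_; _,_)
open import Relation.Binary.PropositionalEquality using (_≡_)
open import Relation.Unary using (Pred; _∈_)

-- Product  s₁ · s₂ ⋯ sₙ  of a sequence of naturals (indices 1..n); empty product = 1.
prodTo : (ℕ → ℕ) → ℕ → ℕ
prodTo s zero    = 1
prodTo s (suc n) = prodTo s n ℕ.* s (suc n)

module _ {c ℓ : Level} (R : Ring c ℓ) where
  open Ring R

  diff : Carrier → Carrier → Carrier
  diff x y = x + (- y)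

  pow : Carrier → ℕ → Carrier
  pow x zero    = 1#
  pow x (suc n) = x * pow x n

  natMul : ℕ → Carrier → Carrier
  natMul zero    x = 0#
  natMul (suc n) x = x + natMul n x

  prodFin : {t : ℕ} → (Fin t → Carrier) → Carrier
  prodFin {zero}  a = 1#
  prodFin {suc t} a = a Fin.zero * prodFin (λ j → a (Fin.suc j))
    where import Data.Fin as Fin

  record IsIdeal {p : Level} (I : Pred Carrier p) : Set (c ⊔ ℓ ⊔ p) where
    field
      resp   : ∀ {x y} → x ≈ y → x ∈ I → y ∈ I
      zero∈  : 0# ∈ I
      +-clo  : ∀ {x y} → x ∈ I → y ∈ I → (x + y) ∈ I
      neg-clo : ∀ {x} → x ∈ I → (- x) ∈ I
      *ˡ-clo : ∀ r {x} → x ∈ I → (r * x) ∈ I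
      *ʳ-clo : ∀ r {x} → x ∈ I → (x * r) ∈ I

  _⊆ᵢ_ : {p : Level} → Pred Carrier p → Pred Carrier p → Set (c ⊔ p)
  I ⊆ᵢ J = ∀ {x} → x ∈ I → x ∈ J

  -- I^t ⊆ J : every product of t elements of I lies in J
  -- (equivalent to containment of the ideal power I^t, since J is an ideal)
  PowSubset : {p : Level} → Pred Carrier p → ℕ → Pred Carrier p → Set (c ⊔ p)
  PowSubset I t J = (a : Fin t → Carrier) → (∀ j → a j ∈ I) → prodFin a ∈ J

  MulSubset : {p : Level} → ℕ → Pred Carrier p → Pred Carrier p → Set (c ⊔ p)
  MulSubset s I J = ∀ {x} → x ∈ I → natMul s x ∈ J

  PrimeFactorsGe : ℕ → ℕ → Set
  PrimeFactorsGe s t = ∀ q → Prime q → q ∣ s → t ≤ q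

  -- CNC-condition for N₁,…,N_k  (indices 1..k of N : ℕ → Pred)
  record CNC {p : Level} (k : ℕ) (N : ℕ → Pred Carrier p) : Set (c ⊔ ℓ ⊔ p) where
    field
      k≥1    : 1 ≤ k
      ideal  : ∀ i → 1 ≤ i → i ≤ k → IsIdeal (N i)
      Nk≡0   : ∀ x → (x ∈ N k → x ≈ 0#) × (x ≈ 0# → x ∈ N k)
      chain  : ∀ i → 1 ≤ i → i < k → N (suc i) ⊆ᵢ N i
      nilp   : ∀ i → 1 ≤ i → i < k →
               Σ ℕ λ t → Σ ℕ λ s →
                 2 ≤ t × PowSubset (N i) t (N (suc i)) ×
                 1 ≤ s × MulSubset s (N i) (N (suc i)) × PrimeFactorsGe s t

  record IsNilIndex {p : Level} (N : ℕ → Pred Carrier p) (i t : ℕ) : Set (c ⊔ p) where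
    field
      t≥2  : 2 ≤ t
      pow⊆ : PowSubset (N i) t (N (suc i))
      min  : ∀ t' → 2 ≤ t' → PowSubset (N i) t' (N (suc i)) → t ≤ t'

  record IsCharacteristic {p : Level} (N : ℕ → Pred Carrier p) (i t s : ℕ) : Set (c ⊔ p) where
    field
      s≥1  : 1 ≤ s
      mul⊆ : MulSubset s (N i) (N (suc i))
      pf   : PrimeFactorsGe s t
      min  : ∀ s' → 1 ≤ s' → MulSubset s' (N i) (N (suc i)) → PrimeFactorsGe s' t → s ≤ s'

  IsUnit : Carrier → Set (c ⊔ ℓ)
  IsUnit x = ∃ λ y → (x * y ≈ 1#) × (y * x ≈ 1#)

  IsUnitMod : {p : Level} → Pred Carrier p → Carrier → Set (c ⊔ p)
  IsUnitMod I x = ∃ λ y → (diff (x * y) 1# ∈ I) × (diff (y * x) 1# ∈ I)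

  -- |(R/I)^*| = n : a bijection Fin n ≅ (R/I)^*
  HasCardUnitsMod : {p : Level} → Pred Carrier p → ℕ → Set (c ⊔ p)
  HasCardUnitsMod I n =
    Σ (Fin n → Carrier) λ f →
      (∀ i → IsUnitMod I (f i)) ×
      (∀ x → IsUnitMod I x → ∃ λ i → diff x (f i) ∈ I) ×
      (∀ i j → diff (f i) (f j) ∈ I → i ≡ j)

  -- |I| = n : a bijection Fin n ≅ I (elements up to ≈)
  HasCardSubset : {p : Level} → Pred Carrier p → ℕ → Set (c ⊔ ℓ ⊔ p)
  HasCardSubset I n =
    Σ (Fin n → Carrier) λ g →
      (∀ i → g i ∈ I) ×
      (∀ x → x ∈ I → ∃ λ i → x ≈ g i) ×
      (∀ i j → g i ≈ g j → i ≡ j)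

  UnitsFinite : Set (c ⊔ ℓ)
  UnitsFinite =
    ∃ λ n → Σ (Fin n → Carrier) λ f →
      (∀ i → IsUnit (f i)) ×
      (∀ x → IsUnit x → ∃ λ i → x ≈ f i) ×
      (∀ i j → f i ≈ f j → i ≡ j)

{-# OPTIONS --safe #-}
-- For (1), the congruence x^w ≡ 1 (mod N₁) is pushed down the chain: if a = 1 + h with
-- h ∈ N_i, then every term C(s_i, j) h^j (j > 0) of a^{s_i} lies in N_{i+1}, via
-- N_i^{t_i} ⊆ N_{i+1} when j ≥ t_i and via s_i N_i ⊆ N_{i+1} when j < t_i, since then s_i
-- divides C(s_i, j) (all prime factors of s_i are ≥ t_i > j).  As N_k = 0 this gives (1).
-- (2) and (3) use Lagrange's theorem in the form: if x permutes a finite set S and x^m fixes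
-- a point of S only when x^m = 1, then all orbits of x on S have the same length d, and
-- counting least elements of orbits shows d ∣ |S|, so x^{|S|} = 1.  Here x acts on (R/N₁)^*,
-- giving x^{|(R/N₁)^*|} ≡ 1 (mod N₁), and u = x^{|(R/N₁)^*|} acts on 1 + N₁, freely because
-- N₁ is a nil ideal.
module Submission where

open import Defs
open import Level using (Level; 0ℓ; _⊔_)
open import Algebra.Bundles using (Monoid; Ring)
open import Data.Nat as Nat
  using (ℕ; zero; suc; _∸_; _≤_; _<_; z≤n; s≤s; _<?_; _≤?_; >-nonZero)
open import Data.Nat.Properties as NatP
  using ( <⇒≢; <⇒≱; <⇒≤; ≤-trans; ≤-antisym; ≤-<-trans; ≤-reflexive; ≮⇒≥; n<1+n
        ; m+[n∸m]≡n; m∸n≤m; m<n⇒0<n∸m; anyUpTo?; ≤-totalOrder; +-0-commutativeMonoid )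
open import Data.Nat.Combinatorics using (_C_; nC1≡n; nCk+nC[k+1]≡[n+1]C[k+1])
open import Data.Nat.Divisibility using (_∣_; divides; ∣⇒≤; ∣-trans; 0∣⇒≡0; m∣m*n)
open import Data.Nat.DivMod using (_%_; _/_; m≡m%n+[m/n]*n; m%n<n)
open import Data.Nat.Induction using (<-rec)
open import Data.Nat.Primality using (Prime)
open import Data.Nat.Primality.Factorisation using (factorise)
open import Data.Nat.Coprimality using (Coprime; coprime-divisor)
open import Data.Nat.ListAction using (product)
open import Data.Fin as Fin using (Fin; toℕ; fromℕ<; punchIn)
open import Data.Fin.Patterns using (0F)
open import Data.Fin.Properties
  using (toℕ-injective; toℕ-fromℕ<; toℕ<n; <-cmp; pigeonhole; all?; any?; punchInᵢ≢i)
  renaming (_≟_ to _≟ᶠ_)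
open import Data.Fin.Permutation using (Permutation; permutation)
open import Data.List.Base using ([]; _∷_; allFin)
open import Data.List.Relation.Unary.All as All using (_∷_)
open import Data.List.Membership.Propositional.Properties using (∈-allFin)
open import Data.List.Extrema ≤-totalOrder using (argmin; f[argmin]≤f[xs])
open import Data.Product using (Σ; ∃; _×_; _,_; proj₁; proj₂)
open import Data.Empty using (⊥-elim)
open import Function using (_∘_)
open import Relation.Binary using (Rel; IsEquivalence; tri<; tri≈; tri>)
open import Relation.Binary.PropositionalEquality as ≡ using (_≡_; _≢_)
open import Relation.Nullary using (Dec; yes; no; ¬_; _×-dec_)
open import Relation.Unary using (Pred; Decidable; _∈_)
import Algebra.Definitions.RawMonoid as RawMonoidDefinitions
import Algebra.Properties.AbelianGroup as AbelianGroupProperties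
import Algebra.Properties.CommutativeMonoid.Sum as CommutativeMonoidSum
import Algebra.Properties.Monoid as MonoidProperties
import Algebra.Properties.Monoid.Mult as MonoidMultProperties
import Algebra.Properties.Ring as RingProperties
import Algebra.Properties.Semiring.Binomial as Binomial
import Algebra.Properties.Semiring.Exp as SemiringExp
import Function.Endo.Propositional as Endo
import Relation.Binary.Reasoning.Setoid as SetoidReasoning

-- Divisibility of binomial coefficients

module BinomialCoefficients where
  open Nat using (_+_; _*_)
  open NatP using (+-identityʳ; *-identityʳ; *-zeroʳ; *-comm; *-distribˡ-+; +-assoc)
  open ≡ using (refl; sym; trans; cong; cong₂; subst; module ≡-Reasoning)

  [1+k]*[1+n]C[1+k]≡[1+n]*nCk : ∀ n k → suc k * (suc n C suc k) ≡ suc n * (n C k)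
  [1+k]*[1+n]C[1+k]≡[1+n]*nCk zero    zero    = refl
  [1+k]*[1+n]C[1+k]≡[1+n]*nCk zero    (suc k) = *-zeroʳ (suc (suc k))
  [1+k]*[1+n]C[1+k]≡[1+n]*nCk (suc n) zero    =
    trans (+-identityʳ _) (trans (nC1≡n (suc (suc n))) (sym (*-identityʳ (suc (suc n)))))
  [1+k]*[1+n]C[1+k]≡[1+n]*nCk (suc n) (suc k) = begin
    suc (suc k) * (suc (suc n) C suc (suc k))    ≡⟨ cong (suc (suc k) *_) (pascal (suc n) (suc k)) ⟨
    suc (suc k) * (A + B)                        ≡⟨ *-distribˡ-+ (suc (suc k)) A B ⟩
    (A + suc k * A) + suc (suc k) * B            ≡⟨ cong₂ (λ u v → (A + u) + v) (absorb n k) (absorb n (suc k)) ⟩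
    (A + suc n * (n C k)) + suc n * (n C suc k)  ≡⟨ +-assoc A _ _ ⟩
    A + (suc n * (n C k) + suc n * (n C suc k))  ≡⟨ cong (A +_) (*-distribˡ-+ (suc n) (n C k) (n C suc k)) ⟨
    A + suc n * (n C k + n C suc k)              ≡⟨ cong (λ u → A + suc n * u) (pascal n k) ⟩
    A + suc n * A                                ∎
    where
    open ≡-Reasoning
    A = suc n C suc k
    B = suc n C suc (suc k)
    pascal = nCk+nC[k+1]≡[n+1]C[k+1]
    absorb = [1+k]*[1+n]C[1+k]≡[1+n]*nCk

  prime-divisor : ∀ {m} → 2 ≤ m → ∃ λ q → Prime q × q ∣ m
  prime-divisor {m} 2≤m with factorise m {{>-nonZero (≤-trans (s≤s z≤n) 2≤m)}}
  ... | record { factors = [] ; isFactorisation = m≡1 } = ⊥-elim (<⇒≢ 2≤m (sym m≡1))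
  ... | record { factors = q ∷ qs ; isFactorisation = m≡q*qs ; factorsPrime = q-prime ∷ _ } =
    q , q-prime , subst (q ∣_) (sym m≡q*qs) (m∣m*n (product qs))

  primeFactors≥⇒coprime : ∀ {s t k} → (∀ q → Prime q → q ∣ s → t ≤ q) → 0 < k → k < t →
                          Coprime s k
  primeFactors≥⇒coprime _ 0<k _ {zero} (_ , 0∣k) = ⊥-elim (<⇒≢ 0<k (sym (0∣⇒≡0 0∣k)))
  primeFactors≥⇒coprime _ _   _ {suc zero} _ = refl
  primeFactors≥⇒coprime {k = suc k} pf _ k<t {suc (suc d)} (d∣s , d∣k)
    with prime-divisor {suc (suc d)} (s≤s (s≤s z≤n))
  ... | q , q-prime , q∣d =
    ⊥-elim (<⇒≱ k<t (≤-trans (pf q q-prime (∣-trans q∣d d∣s)) (≤-trans (∣⇒≤ q∣d) (∣⇒≤ d∣k))))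

  ∣nCk : ∀ {n t k} → 0 < n → (∀ q → Prime q → q ∣ n → t ≤ q) → 0 < k → k < t → n ∣ n C k
  ∣nCk {suc n} {k = suc k} _ pf 0<k k<t =
    coprime-divisor (primeFactors≥⇒coprime pf 0<k k<t)
      (divides (n C k) (trans ([1+k]*[1+n]C[1+k]≡[1+n]*nCk n k) (*-comm (suc n) (n C k))))

open BinomialCoefficients using (∣nCk)

-- Orbits of a map on a finite set

module Counting where
  open Nat using (_+_; _*_)
  open ≡ using (refl; cong; cong₂; module ≡-Reasoning)
  open CommutativeMonoidSum +-0-commutativeMonoid
    using (sum-syntax; sum-remove; sum-cong-≗; sum-replicate-zero)

  𝟙 : ∀ {a} {A : Set a} → Dec A → ℕ
  𝟙 (yes _) = 1
  𝟙 (no _)  = 0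

  𝟙-yes : ∀ {a} {A : Set a} (a? : Dec A) → A → 𝟙 a? ≡ 1
  𝟙-yes (yes _) _ = refl
  𝟙-yes (no ¬a) a = ⊥-elim (¬a a)

  𝟙-no : ∀ {a} {A : Set a} (a? : Dec A) → ¬ A → 𝟙 a? ≡ 0
  𝟙-no (yes a) ¬a = ⊥-elim (¬a a)
  𝟙-no (no _)  _  = refl

  ∑-const : ∀ n c → ∑[ i < n ] c ≡ n * c
  ∑-const zero    c = refl
  ∑-const (suc n) c = cong (c +_) (∑-const n c)

  ∑𝟙-unique : ∀ {n p} {P : Pred (Fin n) p} (P? : Decidable P) (i : Fin n) →
              P i → (∀ j → P j → j ≡ i) → ∑[ j < n ] 𝟙 (P? j) ≡ 1
  ∑𝟙-unique {suc n} P? i Pi unique = begin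
    ∑[ j < suc n ] 𝟙 (P? j)                     ≡⟨ sum-remove {i = i} (𝟙 ∘ P?) ⟩
    𝟙 (P? i) + ∑[ j < n ] 𝟙 (P? (punchIn i j))  ≡⟨ cong₂ _+_ (𝟙-yes (P? i) Pi) (sum-cong-≗ others≡0) ⟩
    1 + ∑[ j < n ] 0                            ≡⟨ cong (1 +_) (sum-replicate-zero n) ⟩
    1                                           ∎
    where
    open ≡-Reasoning
    others≡0 : ∀ j → 𝟙 (P? (punchIn i j)) ≡ 0
    others≡0 j = 𝟙-no (P? (punchIn i j)) (punchInᵢ≢i i j ∘ unique (punchIn i j))

module Iteration {n : ℕ} (f : Fin n → Fin n) where
  open Nat using (_+_; _*_)
  open NatP using (*-identityʳ; *-comm; *-suc; +-comm; +-assoc)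
  open ≡ using (refl; sym; trans; cong; cong-app; subst; module ≡-Reasoning)
  open Endo (Fin n) using (_^_; ^-homo)
  open Counting
  open CommutativeMonoidSum +-0-commutativeMonoid
    using (sum-syntax; ∑-comm; sum-permute; sum-cong-≗)

  IsPeriod : ℕ → Set
  IsPeriod d = ∀ x → (f ^ d) x ≡ x

  IsFreeBelow : ℕ → Set
  IsFreeBelow d = ∀ m x → 0 < m → m < d → (f ^ m) x ≢ x

  HasMinimalPeriod : Set
  HasMinimalPeriod = ∃ λ e → IsPeriod (suc e) × IsFreeBelow (suc e)

  ^-+ : ∀ a b x → (f ^ (a + b)) x ≡ (f ^ a) ((f ^ b) x)
  ^-+ a b x = cong-app (^-homo f a b) x

  fixes-after-difference : ∀ {a b} x → a ≤ b → (f ^ a) x ≡ (f ^ b) x →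
                           (f ^ (b ∸ a)) ((f ^ a) x) ≡ (f ^ a) x
  fixes-after-difference {a} {b} x a≤b fᵃx≡fᵇx = begin
    (f ^ (b ∸ a)) ((f ^ a) x)  ≡⟨ ^-+ (b ∸ a) a x ⟨
    (f ^ (b ∸ a + a)) x        ≡⟨ cong (λ m → (f ^ m) x) (trans (+-comm (b ∸ a) a) (m+[n∸m]≡n a≤b)) ⟩
    (f ^ b) x                  ≡⟨ fᵃx≡fᵇx ⟨
    (f ^ a) x                  ∎
    where open ≡-Reasoning

  module Periodic (e : ℕ) (periodic : IsPeriod (suc e)) where

    d : ℕ
    d = suc e

    ^[q*d]≡id : ∀ q x → (f ^ (q * d)) x ≡ x
    ^[q*d]≡id zero    x = refl
    ^[q*d]≡id (suc q) x = begin
      (f ^ (d + q * d)) x        ≡⟨ ^-+ d (q * d) x ⟩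
      (f ^ d) ((f ^ (q * d)) x)  ≡⟨ cong (f ^ d) (^[q*d]≡id q x) ⟩
      (f ^ d) x                  ≡⟨ periodic x ⟩
      x                          ∎
      where open ≡-Reasoning

    multiple⇒^≡id : ∀ {m} → d ∣ m → IsPeriod m
    multiple⇒^≡id (divides q refl) = ^[q*d]≡id q

    ^≡^[mod] : ∀ a x → (f ^ a) x ≡ (f ^ (a % d)) x
    ^≡^[mod] a x = begin
      (f ^ a) x                              ≡⟨ cong (λ m → (f ^ m) x) (m≡m%n+[m/n]*n a d) ⟩
      (f ^ (a % d + (a / d) * d)) x          ≡⟨ ^-+ (a % d) ((a / d) * d) x ⟩
      (f ^ (a % d)) ((f ^ ((a / d) * d)) x)  ≡⟨ cong (f ^ (a % d)) (^[q*d]≡id (a / d) x) ⟩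
      (f ^ (a % d)) x                        ∎
      where open ≡-Reasoning

    orbit-index : ∀ a x → ∃ λ (k : Fin d) → (f ^ a) x ≡ (f ^ toℕ k) x
    orbit-index a x =
      fromℕ< (m%n<n a d) ,
      trans (^≡^[mod] a x) (cong (λ m → (f ^ m) x) (sym (toℕ-fromℕ< (m%n<n a d))))

    orbit-step : ∀ a b x → ∃ λ (k : Fin d) → (f ^ toℕ k) ((f ^ a) x) ≡ (f ^ b) x
    orbit-step a b x with orbit-index (b + e * a) ((f ^ a) x)
    ... | k , eq = k , (begin
      (f ^ toℕ k) ((f ^ a) x)        ≡⟨ eq ⟨
      (f ^ (b + e * a)) ((f ^ a) x)  ≡⟨ ^-+ (b + e * a) a x ⟨
      (f ^ (b + e * a + a)) x        ≡⟨ cong (λ m → (f ^ m) x) b+ea+a≡b+ad ⟩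
      (f ^ (b + a * d)) x            ≡⟨ ^-+ b (a * d) x ⟩
      (f ^ b) ((f ^ (a * d)) x)      ≡⟨ cong (f ^ b) (^[q*d]≡id a x) ⟩
      (f ^ b) x                      ∎)
      where
      open ≡-Reasoning
      b+ea+a≡b+ad : b + e * a + a ≡ b + a * d
      b+ea+a≡b+ad = trans (+-assoc b (e * a) a)
        (cong (b +_) (trans (+-comm (e * a) a) (trans (cong (a +_) (*-comm e a)) (sym (*-suc a e)))))

    ^-permutation : Fin d → Permutation n n
    ^-permutation m = permutation (f ^ toℕ m) (f ^ (d ∸ toℕ m))
      (cancel (toℕ m) (d ∸ toℕ m) m+[d∸m]≡d)
      (cancel (d ∸ toℕ m) (toℕ m) (trans (+-comm (d ∸ toℕ m) (toℕ m)) m+[d∸m]≡d))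
      where
      m+[d∸m]≡d = m+[n∸m]≡n (<⇒≤ (toℕ<n m))
      cancel : ∀ a b → a + b ≡ d → ∀ x → (f ^ a) ((f ^ b) x) ≡ x
      cancel a b a+b≡d x = trans (sym (^-+ a b x)) (trans (cong (λ m → (f ^ m) x) a+b≡d) (periodic x))

    module Free (free : IsFreeBelow d) where

      no-collision : ∀ {a b} x → a < b → b < d → (f ^ a) x ≢ (f ^ b) x
      no-collision {a} {b} x a<b b<d fᵃx≡fᵇx =
        free (b ∸ a) ((f ^ a) x) (m<n⇒0<n∸m a<b) (≤-<-trans (m∸n≤m b a) b<d)
             (fixes-after-difference x (<⇒≤ a<b) fᵃx≡fᵇx)

      orbit-injective : ∀ x (m₁ m₂ : Fin d) → (f ^ toℕ m₁) x ≡ (f ^ toℕ m₂) x → m₁ ≡ m₂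
      orbit-injective x m₁ m₂ eq with <-cmp m₁ m₂
      ... | tri< m₁<m₂ _ _ = ⊥-elim (no-collision x m₁<m₂ (toℕ<n m₂) eq)
      ... | tri≈ _ m₁≡m₂ _ = m₁≡m₂
      ... | tri> _ _ m₂<m₁ = ⊥-elim (no-collision x m₂<m₁ (toℕ<n m₁) (sym eq))

      IsLeast : Pred (Fin n) 0ℓ
      IsLeast y = ∀ (m : Fin d) → toℕ y ≤ toℕ ((f ^ toℕ m) y)

      isLeast? : Decidable IsLeast
      isLeast? y = all? (λ m → toℕ y ≤? toℕ ((f ^ toℕ m) y))

      one-least-per-orbit : ∀ x → ∑[ m < d ] 𝟙 (isLeast? ((f ^ toℕ m) x)) ≡ 1
      one-least-per-orbit x = ∑𝟙-unique (isLeast? ∘ orbit) m₀ (minimal⇒least {m₀} m₀-minimal) unique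
        where
        orbit : Fin d → Fin n
        orbit m = (f ^ toℕ m) x

        m₀ : Fin d
        m₀ = argmin (toℕ ∘ orbit) 0F (allFin d)

        m₀-minimal : ∀ m → toℕ (orbit m₀) ≤ toℕ (orbit m)
        m₀-minimal m = All.lookup (f[argmin]≤f[xs] {f = toℕ ∘ orbit} 0F (allFin d)) (∈-allFin m)

        minimal⇒least : ∀ {m₁} → (∀ m → toℕ (orbit m₁) ≤ toℕ (orbit m)) → IsLeast (orbit m₁)
        minimal⇒least {m₁} minimal m with orbit-index (toℕ m + toℕ m₁) x
        ... | k , eq =
          ≤-trans (minimal k) (≤-reflexive (cong toℕ (trans (sym eq) (^-+ (toℕ m) (toℕ m₁) x))))

        least-below : ∀ {m₁} → IsLeast (orbit m₁) → ∀ m₂ → toℕ (orbit m₁) ≤ toℕ (orbit m₂)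
        least-below {m₁} least m₂ with orbit-step (toℕ m₁) (toℕ m₂) x
        ... | k , eq = subst (toℕ (orbit m₁) ≤_) (cong toℕ eq) (least k)

        unique : ∀ m → IsLeast (orbit m) → m ≡ m₀
        unique m least = orbit-injective x m m₀ (toℕ-injective (≤-antisym
          (least-below {m} least m₀) (least-below {m₀} (minimal⇒least {m₀} m₀-minimal) m)))

      period∣size : d ∣ n
      period∣size = divides r (begin
        n                                                   ≡⟨ *-identityʳ n ⟨
        n * 1                                               ≡⟨ ∑-const n 1 ⟨
        ∑[ x < n ] 1                                        ≡⟨ sum-cong-≗ one-least-per-orbit ⟨
        ∑[ x < n ] ∑[ m < d ] 𝟙 (isLeast? ((f ^ toℕ m) x))  ≡⟨ ∑-comm {n} {d} (λ x m → 𝟙 (isLeast? ((f ^ toℕ m) x))) ⟩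
        ∑[ m < d ] ∑[ x < n ] 𝟙 (isLeast? ((f ^ toℕ m) x))  ≡⟨ sum-cong-≗ permute ⟨
        ∑[ m < d ] r                                        ≡⟨ ∑-const d r ⟩
        d * r                                               ≡⟨ *-comm d r ⟩
        r * d                                               ∎)
        where
        open ≡-Reasoning
        r = ∑[ y < n ] 𝟙 (isLeast? y)
        permute : ∀ m → r ≡ ∑[ x < n ] 𝟙 (isLeast? ((f ^ toℕ m) x))
        permute m = sum-permute (𝟙 ∘ isLeast?) (^-permutation m)

  module _ (uniform : ∀ m x y → (f ^ m) x ≡ x → (f ^ m) y ≡ y) where

    minimal-period : ∀ p → 0 < p → IsPeriod p → HasMinimalPeriod
    minimal-period = <-rec (λ p → 0 < p → IsPeriod p → HasMinimalPeriod) search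
      where
      search : ∀ p → (∀ {m} → m < p → 0 < m → IsPeriod m → HasMinimalPeriod) →
               0 < p → IsPeriod p → HasMinimalPeriod
      search (suc e) shorter _ periodic
        with anyUpTo? (λ m → (0 <? m) ×-dec any? (λ x → (f ^ m) x ≟ᶠ x)) (suc e)
      ... | yes (m , m<p , 0<m , x , fixed) = shorter m<p 0<m (λ y → uniform m x y fixed)
      ... | no none = e , periodic , λ m x 0<m m<p fixed → none (m , m<p , 0<m , x , fixed)

    ^-size≡id : IsPeriod n
    ^-size≡id x with pigeonhole (n<1+n n) (λ (m : Fin (suc n)) → (f ^ toℕ m) x)
    ... | i , j , i<j , fⁱx≡fʲx
      with minimal-period (toℕ j ∸ toℕ i) (m<n⇒0<n∸m i<j) (λ y → uniform (toℕ j ∸ toℕ i) ((f ^ toℕ i) x) y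
             (fixes-after-difference {toℕ i} {toℕ j} x (<⇒≤ i<j) fⁱx≡fʲx))
    ... | e , periodic , free =
      Periodic.multiple⇒^≡id e periodic (Periodic.Free.period∣size e periodic free) x

-- Lagrange's theorem for a freely acting monoid element

module Lagrange {a ℓ} (M : Monoid a ℓ) where
  open Monoid M
  open MonoidProperties M using (cancelᶜ; insertʳ)
  open SetoidReasoning setoid

  infixr 8 _^_
  _^_ : Carrier → ℕ → Carrier
  x ^ m = RawMonoidDefinitions._×_ rawMonoid m x

  IsInvertible : Carrier → Set (a ⊔ ℓ)
  IsInvertible x = ∃ λ y → x ∙ y ≈ ε × y ∙ x ≈ ε

  HasCardUnits : ℕ → Set (a ⊔ ℓ)
  HasCardUnits n = Σ (Fin n → Carrier) λ e →
    (∀ i → IsInvertible (e i)) ×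
    (∀ x → IsInvertible x → ∃ λ i → x ≈ e i) ×
    (∀ i j → e i ≈ e j → i ≡ j)

  free-action⇒^size≈ε : ∀ {n} x (e : Fin n → Carrier) →
                        (∀ i → ∃ λ j → x ∙ e i ≈ e j) →
                        (∀ i j → e i ≈ e j → i ≡ j) →
                        (∀ m i → x ^ m ∙ e i ≈ e i → x ^ m ≈ ε) →
                        x ^ n ≈ ε
  free-action⇒^size≈ε {zero}  x e maps-to injective free = refl
  free-action⇒^size≈ε {suc n} x e maps-to injective free =
    free (suc n) 0F (trans (orbit (suc n) 0F) (reflexive (≡.cong e (Iteration.^-size≡id σ uniform 0F))))
    where
    open Endo (Fin (suc n)) using () renaming (_^_ to _^ᶠ_)

    σ : Fin (suc n) → Fin (suc n)
    σ i = proj₁ (maps-to i)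

    orbit : ∀ m i → x ^ m ∙ e i ≈ e ((σ ^ᶠ m) i)
    orbit zero    i = identityˡ (e i)
    orbit (suc m) i = begin
      (x ∙ x ^ m) ∙ e i   ≈⟨ assoc x (x ^ m) (e i) ⟩
      x ∙ (x ^ m ∙ e i)   ≈⟨ ∙-congˡ (orbit m i) ⟩
      x ∙ e ((σ ^ᶠ m) i)  ≈⟨ proj₂ (maps-to ((σ ^ᶠ m) i)) ⟩
      e ((σ ^ᶠ suc m) i)  ∎

    uniform : ∀ m i j → (σ ^ᶠ m) i ≡ i → (σ ^ᶠ m) j ≡ j
    uniform m i j σᵐi≡i = injective ((σ ^ᶠ m) j) j (begin
      e ((σ ^ᶠ m) j)  ≈⟨ orbit m j ⟨
      x ^ m ∙ e j     ≈⟨ ∙-congʳ xᵐ≈ε ⟩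
      ε ∙ e j         ≈⟨ identityˡ (e j) ⟩
      e j             ∎)
      where
      xᵐ≈ε : x ^ m ≈ ε
      xᵐ≈ε = free m i (trans (orbit m i) (reflexive (≡.cong e σᵐi≡i)))

  ^-card-units≈ε : ∀ {n} → HasCardUnits n → ∀ {x} → IsInvertible x → x ^ n ≈ ε
  ^-card-units≈ε (e , invertible , covers , injective) {x} (y , xy≈ε , yx≈ε) =
    free-action⇒^size≈ε x e maps-to injective free
    where
    maps-to : ∀ i → ∃ λ j → x ∙ e i ≈ e j
    maps-to i = covers (x ∙ e i) (eᵢ⁻¹ ∙ y , xeᵢ∙eᵢ⁻¹y≈ε , eᵢ⁻¹y∙xeᵢ≈ε)
      where
      eᵢ⁻¹ = proj₁ (invertible i)
      xeᵢ∙eᵢ⁻¹y≈ε : (x ∙ e i) ∙ (eᵢ⁻¹ ∙ y) ≈ ε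
      xeᵢ∙eᵢ⁻¹y≈ε = trans (cancelᶜ (proj₁ (proj₂ (invertible i))) x y) xy≈ε
      eᵢ⁻¹y∙xeᵢ≈ε : (eᵢ⁻¹ ∙ y) ∙ (x ∙ e i) ≈ ε
      eᵢ⁻¹y∙xeᵢ≈ε = trans (cancelᶜ yx≈ε eᵢ⁻¹ (e i)) (proj₂ (proj₂ (invertible i)))

    free : ∀ m i → x ^ m ∙ e i ≈ e i → x ^ m ≈ ε
    free m i xᵐeᵢ≈eᵢ = begin
      x ^ m                 ≈⟨ insertʳ eᵢeᵢ⁻¹≈ε (x ^ m) ⟩
      (x ^ m ∙ e i) ∙ eᵢ⁻¹  ≈⟨ ∙-congʳ xᵐeᵢ≈eᵢ ⟩
      e i ∙ eᵢ⁻¹            ≈⟨ eᵢeᵢ⁻¹≈ε ⟩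
      ε                     ∎
      where
      eᵢ⁻¹ = proj₁ (invertible i)
      eᵢeᵢ⁻¹≈ε = proj₁ (proj₂ (invertible i))

-- Congruences modulo ideals

module _ {c ℓ} (R : Ring c ℓ) where
  open Ring R
  open SemiringExp semiring using (_^_; ^-homo-*; ^-congˡ; ^-congʳ)
  open RawMonoidDefinitions +-rawMonoid using (sum) renaming (_×_ to _·_)
  open MonoidMultProperties +-monoid using (×-assocˡ)
  open AbelianGroupProperties +-abelianGroup
    using ( ⁻¹-anti-homo‿-; x≈y⇒x∙y⁻¹≈ε; x∙y⁻¹≈ε⇒x≈y; \\-leftDividesʳ
          ; //-rightDividesˡ; //-rightDividesʳ; ∙-cancelˡ; inverseˡ-unique )
  open RingProperties R using (x[y-z]≈xy-xz; [y-z]x≈yx-zx; -‿distribʳ-*)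
  open SetoidReasoning setoid

  pow≈^ : ∀ x m → pow R x m ≈ x ^ m
  pow≈^ x zero    = refl
  pow≈^ x (suc m) = *-congˡ (pow≈^ x m)

  natMul≈· : ∀ m x → natMul R m x ≈ m · x
  natMul≈· zero    x = refl
  natMul≈· (suc m) x = +-congˡ (natMul≈· m x)

  prodFin-const : ∀ t x → prodFin R (λ (_ : Fin t) → x) ≈ x ^ t
  prodFin-const zero    x = refl
  prodFin-const (suc t) x = *-congˡ (prodFin-const t x)

  module _ {p} {I : Pred Carrier p} (I-ideal : IsIdeal R I) where
    open IsIdeal I-ideal

    ·-∈ : ∀ m {x} → x ∈ I → m · x ∈ I
    ·-∈ zero    _   = zero∈
    ·-∈ (suc m) x∈I = +-clo x∈I (·-∈ m x∈I)

    ^-∈ : ∀ m {x} → x ∈ I → x ^ suc m ∈ I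
    ^-∈ m {x} x∈I = *ʳ-clo (x ^ m) x∈I

    sum-∈ : ∀ {n} (v : Fin n → Carrier) → (∀ j → v j ∈ I) → sum v ∈ I
    sum-∈ {zero}  v _   = zero∈
    sum-∈ {suc n} v v∈I = +-clo (v∈I 0F) (sum-∈ (v ∘ Fin.suc) (v∈I ∘ Fin.suc))

    infix 4 _∼_
    _∼_ : Rel Carrier p
    x ∼ y = diff R x y ∈ I

    ≈⇒∼ : ∀ {x y} → x ≈ y → x ∼ y
    ≈⇒∼ x≈y = resp (sym (x≈y⇒x∙y⁻¹≈ε x≈y)) zero∈

    ∼-sym : ∀ {x y} → x ∼ y → y ∼ x
    ∼-sym {x} {y} x∼y = resp (⁻¹-anti-homo‿- x y) (neg-clo x∼y)

    ∼-trans : ∀ {x y z} → x ∼ y → y ∼ z → x ∼ z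
    ∼-trans {x} {y} {z} x∼y y∼z = resp telescope (+-clo x∼y y∼z)
      where
      telescope : (x - y) + (y - z) ≈ x - z
      telescope = trans (+-assoc x (- y) (y - z)) (+-congˡ (\\-leftDividesʳ y (- z)))

    ∼-isEquivalence : IsEquivalence _∼_
    ∼-isEquivalence = record { refl = ≈⇒∼ refl ; sym = ∼-sym ; trans = ∼-trans }

    *-cong-∼ : ∀ {x y u v} → x ∼ y → u ∼ v → x * u ∼ y * v
    *-cong-∼ {x} {y} {u} {v} x∼y u∼v = ∼-trans
      (resp (x[y-z]≈xy-xz x u v) (*ˡ-clo x u∼v))
      (resp ([y-z]x≈yx-zx v x y) (*ʳ-clo v x∼y))

    quotient-*-monoid : Monoid c p
    quotient-*-monoid = record
      { _≈_      = _∼_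
      ; _∙_      = _*_
      ; ε        = 1#
      ; isMonoid = record
        { isSemigroup = record
          { isMagma = record { isEquivalence = ∼-isEquivalence ; ∙-cong = *-cong-∼ }
          ; assoc   = λ x y z → ≈⇒∼ (*-assoc x y z)
          }
        ; identity = (λ x → ≈⇒∼ (*-identityˡ x)) , (λ x → ≈⇒∼ (*-identityʳ x))
        }
      }

    unit⇒unit-mod : ∀ {x} → IsUnit R x → IsUnitMod R I x
    unit⇒unit-mod (y , xy≈1 , yx≈1) = y , ≈⇒∼ xy≈1 , ≈⇒∼ yx≈1

    -- HasCardUnitsMod R I is, definitionally, HasCardUnits of the quotient monoid.
    lagrange-mod : ∀ {n x} → HasCardUnitsMod R I n → IsUnitMod R I x → x ^ n ∼ 1#
    lagrange-mod {n} {x} card x-unit =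
      ∼-trans (^∼^ᵢ n) (Lagrange.^-card-units≈ε quotient-*-monoid card x-unit)
      where
      open Lagrange quotient-*-monoid using () renaming (_^_ to _^ᵢ_)
      ^∼^ᵢ : ∀ m → x ^ m ∼ x ^ᵢ m
      ^∼^ᵢ zero    = ≈⇒∼ refl
      ^∼^ᵢ (suc m) = *-cong-∼ (≈⇒∼ refl) (^∼^ᵢ m)

  pow⊆⇒^∈ : ∀ {p} (I : Pred Carrier p) {J : Pred Carrier p} {t x} →
            IsIdeal R J → PowSubset R I t J → x ∈ I → x ^ t ∈ J
  pow⊆⇒^∈ I {t = t} {x} J-ideal Iᵗ⊆J x∈I =
    IsIdeal.resp J-ideal (prodFin-const t x) (Iᵗ⊆J (λ _ → x) (λ _ → x∈I))

  module _ {p} {I J : Pred Carrier p} (I-ideal : IsIdeal R I) (J-ideal : IsIdeal R J)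
           {t s : ℕ} (Iᵗ⊆J : PowSubset R I t J) (sI⊆J : MulSubset R s I J)
           (1≤s : 1 ≤ s) (s-rough : PrimeFactorsGe R s t) where

    binomialTerm-∈ : ∀ {h} → h ∈ I → ∀ (j : Fin s) →
                     Binomial.binomialTerm semiring h 1# s (Fin.suc j) ∈ J
    binomialTerm-∈ {h} h∈I j = by-exponent (k <? t)
      where
      k = suc (toℕ j)
      y = Binomial.binomial semiring h 1# s (Fin.suc j)

      by-exponent : Dec (k < t) → (s C k) · y ∈ J
      by-exponent (yes k<t) with ∣nCk 1≤s s-rough (s≤s z≤n) k<t
      ... | divides q sCk≡q*s =
        IsIdeal.resp J-ideal (trans (×-assocˡ y q s) (reflexive (≡.cong (_· y) (≡.sym sCk≡q*s))))
          (·-∈ J-ideal q {s · y} (IsIdeal.resp J-ideal (natMul≈· s y) (sI⊆J y∈I)))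
        where
        y∈I : y ∈ I
        y∈I = IsIdeal.*ʳ-clo I-ideal (1# ^ (s ∸ k)) (^-∈ I-ideal (toℕ j) h∈I)
      by-exponent (no k≮t) = ·-∈ J-ideal (s C k) {y} (IsIdeal.*ʳ-clo J-ideal (1# ^ (s ∸ k)) hᵏ∈J)
        where
        hᵏ≈hᵗhᵏ⁻ᵗ : h ^ t * h ^ (k ∸ t) ≈ h ^ k
        hᵏ≈hᵗhᵏ⁻ᵗ = trans (sym (^-homo-* h t (k ∸ t))) (^-congʳ h (m+[n∸m]≡n (≮⇒≥ k≮t)))
        hᵏ∈J : h ^ k ∈ J
        hᵏ∈J = IsIdeal.resp J-ideal hᵏ≈hᵗhᵏ⁻ᵗ
                 (IsIdeal.*ʳ-clo J-ideal (h ^ (k ∸ t)) (pow⊆⇒^∈ I J-ideal Iᵗ⊆J h∈I))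

    ≡1[mod-I]⇒^s≡1[mod-J] : ∀ {a} → diff R a 1# ∈ I → diff R (a ^ s) 1# ∈ J
    ≡1[mod-I]⇒^s≡1[mod-J] {a} a-1∈I =
      IsIdeal.resp J-ideal expansion (sum-∈ J-ideal _ (binomialTerm-∈ a-1∈I))
      where
      h = a - 1#
      open Binomial semiring h 1# using (binomialTerm; theorem)
      rest = sum (λ j → binomialTerm s (Fin.suc j))

      1^≈1 : ∀ m → 1# ^ m ≈ 1#
      1^≈1 zero    = refl
      1^≈1 (suc m) = trans (*-identityˡ _) (1^≈1 m)

      leading≈1 : binomialTerm s 0F ≈ 1#
      leading≈1 = trans (+-identityʳ _) (trans (*-identityˡ _) (1^≈1 s))

      expansion : rest ≈ a ^ s - 1#
      expansion = sym (begin
        a ^ s - 1#                       ≈⟨ +-congʳ (^-congˡ s (//-rightDividesˡ 1# a)) ⟨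
        (h + 1#) ^ s - 1#                ≈⟨ +-congʳ (theorem (trans (*-identityʳ h) (sym (*-identityˡ h))) s) ⟩
        (binomialTerm s 0F + rest) - 1#  ≈⟨ +-congʳ (+-congʳ leading≈1) ⟩
        (1# + rest) - 1#                 ≈⟨ +-congʳ (+-comm 1# rest) ⟩
        (rest + 1#) - 1#                 ≈⟨ //-rightDividesʳ 1# rest ⟩
        rest                             ∎)

  absorbed-by-nilpotent⇒≈0 : ∀ {h z} T → h ≈ h * z → z ^ T ≈ 0# → h ≈ 0#
  absorbed-by-nilpotent⇒≈0 {h} {z} T h≈hz zᵀ≈0 = begin
    h          ≈⟨ absorbs T ⟩
    h * z ^ T  ≈⟨ *-congˡ zᵀ≈0 ⟩
    h * 0#     ≈⟨ zeroʳ h ⟩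
    0#         ∎
    where
    absorbs : ∀ m → h ≈ h * z ^ m
    absorbs zero    = sym (*-identityʳ h)
    absorbs (suc m) = trans (absorbs m) (trans (*-congʳ h≈hz) (*-assoc h z (z ^ m)))

  *[1+nilpotent]≈0⇒≈0 : ∀ {h g} T → (- g) ^ T ≈ 0# → h * (1# + g) ≈ 0# → h ≈ 0#
  *[1+nilpotent]≈0⇒≈0 {h} {g} T [-g]ᵀ≈0 h[1+g]≈0 =
    absorbed-by-nilpotent⇒≈0 T (trans h≈-hg (-‿distribʳ-* h g)) [-g]ᵀ≈0
    where
    h+hg≈0 : h + h * g ≈ 0#
    h+hg≈0 = trans (sym (trans (distribˡ h 1# g) (+-congʳ (*-identityʳ h)))) h[1+g]≈0
    h≈-hg : h ≈ - (h * g)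
    h≈-hg = inverseˡ-unique h (h * g) h+hg≈0

  module _ {p} {I : Pred Carrier p} (I-ideal : IsIdeal R I)
           (I-nil : ∀ {g} → g ∈ I → ∃ λ T → g ^ T ≈ 0#) where

    ≡1[mod-nil]⇒^∣I∣≈1 : ∀ {b u} → HasCardSubset R I b → diff R u 1# ∈ I → u ^ b ≈ 1#
    ≡1[mod-nil]⇒^∣I∣≈1 {b} {u} (g , g∈I , covers , injective) u-1∈I =
      Lagrange.free-action⇒^size≈ε *-monoid u e maps-to e-injective free
      where
      e : Fin b → Carrier
      e i = 1# + g i

      e-1≈g : ∀ i → e i - 1# ≈ g i
      e-1≈g i = trans (+-congʳ (+-comm 1# (g i))) (//-rightDividesʳ 1# (g i))

      ue-1∈I : ∀ i → u * e i - 1# ∈ I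
      ue-1∈I i = ∼-trans I-ideal (*-cong-∼ I-ideal u-1∈I (≈⇒∼ I-ideal refl))
        (∼-trans I-ideal (≈⇒∼ I-ideal (*-identityˡ (e i))) (IsIdeal.resp I-ideal (sym (e-1≈g i)) (g∈I i)))

      maps-to : ∀ i → ∃ λ j → u * e i ≈ e j
      maps-to i with covers (u * e i - 1#) (ue-1∈I i)
      ... | j , ue-1≈gⱼ =
        j , trans (sym (//-rightDividesˡ 1# (u * e i))) (trans (+-congʳ ue-1≈gⱼ) (+-comm (g j) 1#))

      e-injective : ∀ i j → e i ≈ e j → i ≡ j
      e-injective i j eᵢ≈eⱼ = injective i j (∙-cancelˡ 1# (g i) (g j) eᵢ≈eⱼ)

      free : ∀ m i → u ^ m * e i ≈ e i → u ^ m ≈ 1#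
      free m i uᵐeᵢ≈eᵢ = x∙y⁻¹≈ε⇒x≈y (u ^ m) 1#
        (*[1+nilpotent]≈0⇒≈0 (proj₁ -gᵢ-nil) (proj₂ -gᵢ-nil) [uᵐ-1]eᵢ≈0)
        where
        -gᵢ-nil = I-nil (IsIdeal.neg-clo I-ideal (g∈I i))
        [uᵐ-1]eᵢ≈0 : (u ^ m - 1#) * e i ≈ 0#
        [uᵐ-1]eᵢ≈0 = trans ([y-z]x≈yx-zx (e i) (u ^ m) 1#)
                           (x≈y⇒x∙y⁻¹≈ε (trans uᵐeᵢ≈eᵢ (sym (*-identityˡ (e i)))))

-- The CNC chain

module _ {c ℓ p} {R : Ring c ℓ} {k : ℕ} {N : ℕ → Pred (Ring.Carrier R) p} (cnc : CNC R k N) where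
  open Ring R
  open CNC cnc
  open SemiringExp semiring using (_^_; ^-assocʳ)
  open AbelianGroupProperties +-abelianGroup using (x∙y⁻¹≈ε⇒x≈y)

  N[1+i]-ideal : ∀ {i} → suc i ≤ k → IsIdeal R (N (suc i))
  N[1+i]-ideal = ideal (suc _) (s≤s z≤n)

  1+[k∸1]≡k : suc (k ∸ 1) ≡ k
  1+[k∸1]≡k = m+[n∸m]≡n k≥1

  ∈N[1+[k∸1]]⇒≈0 : ∀ {x} → x ∈ N (suc (k ∸ 1)) → x ≈ 0#
  ∈N[1+[k∸1]]⇒≈0 {x} = proj₁ (Nk≡0 x) ∘ ≡.subst (λ i → x ∈ N i) 1+[k∸1]≡k

  module _ {t : ℕ → ℕ} (nilIndex : ∀ i → 1 ≤ i → i < k → IsNilIndex R N i (t i)) where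

    ∈N₁⇒^∈N : ∀ {y} → y ∈ N 1 → ∀ i → suc i ≤ k → ∃ λ T → y ^ T ∈ N (suc i)
    ∈N₁⇒^∈N {y} y∈N₁ zero    _ =
      1 , IsIdeal.resp (N[1+i]-ideal k≥1) (sym (*-identityʳ y)) y∈N₁
    ∈N₁⇒^∈N {y} y∈N₁ (suc i) 2+i≤k with ∈N₁⇒^∈N y∈N₁ i (<⇒≤ 2+i≤k)
    ... | T , yᵀ∈N = T Nat.* t (suc i) ,
      IsIdeal.resp (N[1+i]-ideal 2+i≤k) (^-assocʳ y T (t (suc i)))
        (pow⊆⇒^∈ R (N (suc i)) (N[1+i]-ideal 2+i≤k)
           (IsNilIndex.pow⊆ (nilIndex (suc i) (s≤s z≤n) 2+i≤k)) yᵀ∈N)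

    N₁-nil : ∀ {y} → y ∈ N 1 → ∃ λ T → y ^ T ≈ 0#
    N₁-nil y∈N₁ with ∈N₁⇒^∈N y∈N₁ (k ∸ 1) (≤-reflexive 1+[k∸1]≡k)
    ... | T , yᵀ∈N = T , ∈N[1+[k∸1]]⇒≈0 yᵀ∈N

    module _ {s : ℕ → ℕ}
             (characteristic : ∀ i → 1 ≤ i → i < k → IsCharacteristic R N i (t i) (s i)) where

      ≡1[mod-N₁]⇒^∏s≡1 : ∀ {a} → diff R a 1# ∈ N 1 →
                         ∀ i → suc i ≤ k → diff R (a ^ prodTo s i) 1# ∈ N (suc i)
      ≡1[mod-N₁]⇒^∏s≡1 {a} a-1∈N₁ zero    _ =
        IsIdeal.resp (N[1+i]-ideal k≥1) (+-congʳ (sym (*-identityʳ a))) a-1∈N₁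
      ≡1[mod-N₁]⇒^∏s≡1 {a} a-1∈N₁ (suc i) 2+i≤k =
        IsIdeal.resp (N[1+i]-ideal 2+i≤k) (+-congʳ (^-assocʳ a (prodTo s i) (s (suc i))))
          (≡1[mod-I]⇒^s≡1[mod-J] R (N[1+i]-ideal (<⇒≤ 2+i≤k)) (N[1+i]-ideal 2+i≤k)
             (IsNilIndex.pow⊆ (nilIndex (suc i) (s≤s z≤n) 2+i≤k)) C.mul⊆ C.s≥1 C.pf
             (≡1[mod-N₁]⇒^∏s≡1 a-1∈N₁ i (<⇒≤ 2+i≤k)))
        where module C = IsCharacteristic (characteristic (suc i) (s≤s z≤n) 2+i≤k)

      ≡1[mod-N₁]⇒^∏s≈1 : ∀ {a} → diff R a 1# ∈ N 1 → a ^ prodTo s (k ∸ 1) ≈ 1#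
      ≡1[mod-N₁]⇒^∏s≈1 {a} a-1∈N₁ = x∙y⁻¹≈ε⇒x≈y (a ^ prodTo s (k ∸ 1)) 1#
        (∈N[1+[k∸1]]⇒≈0 (≡1[mod-N₁]⇒^∏s≡1 a-1∈N₁ (k ∸ 1) (≤-reflexive 1+[k∸1]≡k)))

open Nat using (_*_)

theorem3p2 : ∀ {c ℓ p : Level} (R : Ring c ℓ) (k : ℕ) (N : ℕ → Pred (Ring.Carrier R) p)
    (t s : ℕ → ℕ) →
    CNC R k N →
    (∀ i → 1 ≤ i → i < k → IsNilIndex R N i (t i)) →
    (∀ i → 1 ≤ i → i < k → IsCharacteristic R N i (t i) (s i)) →
    -- (1)
    ((w : ℕ) →
      (∀ x → IsUnitMod R (N 1) x → diff R (pow R x w) (Ring.1# R) ∈ N 1) →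
      ∀ x → IsUnit R x → Ring._≈_ R (pow R x (w * prodTo s (k ∸ 1))) (Ring.1# R))
    ×
    -- (2)
    ((n : ℕ) → HasCardUnitsMod R (N 1) n →
      ∀ x → IsUnit R x → Ring._≈_ R (pow R x (n * prodTo s (k ∸ 1))) (Ring.1# R))
    ×
    -- (3)
    (UnitsFinite R → (a b : ℕ) → HasCardUnitsMod R (N 1) a → HasCardSubset R (N 1) b →
      ∀ x → IsUnit R x → Ring._≈_ R (pow R x (a * b)) (Ring.1# R))
theorem3p2 R k N t s cnc nilIndex characteristic =
    (λ w x^w≡1 x x-unit → pow-*≈1 w _
        (≡1[mod-N₁]⇒^∏s≈1 cnc nilIndex characteristic
          (pow≡1⇒^≡1 {x} {w} (x^w≡1 x (unit⇒unit-mod R N₁-ideal x-unit)))))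
  , (λ n card x x-unit → pow-*≈1 n _
        (≡1[mod-N₁]⇒^∏s≈1 cnc nilIndex characteristic
          (lagrange-mod R N₁-ideal card (unit⇒unit-mod R N₁-ideal x-unit))))
  , (λ _ a b units-card N₁-card x x-unit → pow-*≈1 a b
        (≡1[mod-nil]⇒^∣I∣≈1 R N₁-ideal (N₁-nil cnc nilIndex) N₁-card
          (lagrange-mod R N₁-ideal units-card (unit⇒unit-mod R N₁-ideal x-unit))))
  where
  open Ring R using (_≈_; 1#; trans; sym; +-congʳ)
  open SemiringExp (Ring.semiring R) using (_^_; ^-assocʳ)

  N₁-ideal : IsIdeal R (N 1)
  N₁-ideal = CNC.ideal cnc 1 (s≤s z≤n) (CNC.k≥1 cnc)

  pow≡1⇒^≡1 : ∀ {x w} → diff R (pow R x w) 1# ∈ N 1 → diff R (x ^ w) 1# ∈ N 1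
  pow≡1⇒^≡1 {x} {w} = IsIdeal.resp N₁-ideal (+-congʳ (pow≈^ R x w))

  pow-*≈1 : ∀ {x} a b → (x ^ a) ^ b ≈ 1# → pow R x (a * b) ≈ 1#
  pow-*≈1 {x} a b xᵃᵇ≈1 = trans (pow≈^ R x (a * b)) (trans (sym (^-assocʳ x a b)) xᵃᵇ≈1)
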